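{- Let $p$ be an odd prime with $p \equiv 1, 2$ or $4 \pmod 7$, let $k \in \mathbf{F}_p$ be a root of $x^2 + \frac{1}{2}x + \frac{1}{2}$, and let $R$, $E$, $\pi_p$, $\rho_0$ be as in the context. Let $n$ be a positive integer. Then: (1) $\nu_{\rho_0}(\pi_p^n - 1) \geq 1$; (2) if $\nu_{\rho_0}(\pi_p^n - 1) = 1$, then $\nu_{\rho_0}(\pi_p^n + 1) \geq 2$; (3) if $\nu_{\rho_0}(\pi_p^n - 1) \geq 2$, then $\nu_{\rho_0}(\pi_p^n + 1) = 1$; (4) $\nu_{\rho_0}(\pi_p^{2^{i+1} n} - 1) = \nu_{\rho_0}(\pi_p^{2^i n} - 1) + 1$ for every positive integer $i$.
   Context: $R = \mathbf{Z}[\alpha]$ with $\alpha = \frac{1 + \sqrt{ -7}}{2}$, with complex conjugation $\overline{\cdot}$. $E$ is the elliptic curve $y^2 = x^3 - 35x + 98$ over $\mathbf{F}_p$, whose endomorphism ring is identified with $R$; $\pi_p \in R$ is the element representing the $p$-Frobenius endomorphism $(x,y)\mapsto(x^p,y^p)$ of $E$. Since $R/\pi_p R \cong \mathbf{F}_p$, congruences modulo $\pi_p$ between elements of $R$ and elements of $\mathbf{F}_p$ make sense. Let $\sigma \in \mathbf{F}_p$ be $\sigma \equiv 2k + 1 \pmod p$. Define $\rho_0 = \alpha$ if $\alpha \equiv \sigma \pmod{\pi_p}$, and $\rho_0 = \overline{\alpha}$ if $\overline{\alpha} \equiv \sigma \pmod{\pi_p}$. For $r \in R$ nonzero, $\nu_{\rho_0}(r)$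 is the largest nonnegative integer $e$ such that $\rho_0^e$ divides $r$ in $R$. -}

module Defs where

open import Data.Nat as ℕ using (ℕ; zero; suc)
open import Data.Nat.Divisibility as ℕD using (_∣?_)
open import Data.Integer as ℤ using (ℤ; +_; ∣_∣)
open import Data.List using (List; length; filter; upTo; cartesianProduct)
open import Data.Product using (Σ; ∃; _×_; _,_)
open import Relation.Binary.PropositionalEquality using (_≡_)

-- The ring R = ℤ[α], α = (1 + √-7)/2, α² = α - 2.
-- mkR a b represents a + b α.
record R : Set where
  constructor mkR
  field
    re : ℤ
    im : ℤ
open R public

infixl 6 _+R_ _-R_
infixl 7 _*R_
infixr 8 _^R_

_+R_ : R → R → R
mkR a b +R mkR c d = mkR (a ℤ.+ c) (b ℤ.+ d)

-R_ : R → R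
-R mkR a b = mkR (ℤ.- a) (ℤ.- b)

_-R_ : R → R → R
x -R y = x +R (-R y)

-- (a + bα)(c + dα) = ac + (ad + bc) α + bd α², with α² = α - 2
_*R_ : R → R → R
mkR a b *R mkR c d =
  mkR (a ℤ.* c ℤ.- + 2 ℤ.* (b ℤ.* d)) (a ℤ.* d ℤ.+ b ℤ.* c ℤ.+ b ℤ.* d)

0R 1R αR : R
0R = mkR (+ 0) (+ 0)
1R = mkR (+ 1) (+ 0)
αR = mkR (+ 0) (+ 1)

-- complex conjugation: ᾱ = 1 - α, so conj (a + bα) = (a + b) - bα
conj : R → R
conj (mkR a b) = mkR (a ℤ.+ b) (ℤ.- b)

αbar : R
αbar = conj αR

ι : ℤ → R
ι a = mkR a (+ 0)

_^R_ : R → ℕ → R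
x ^R zero = 1R
x ^R suc n = x *R (x ^R n)

_∣R_ : R → R → Set
x ∣R y = ∃ λ c → c *R x ≡ y

_≡R_[mod_] : R → R → R → Set
r ≡R s [mod π ] = π ∣R (r -R s)

norm : R → ℤ
norm (mkR a b) = a ℤ.* a ℤ.+ a ℤ.* b ℤ.+ + 2 ℤ.* (b ℤ.* b)

trace : R → ℤ
trace (mkR a b) = + 2 ℤ.* a ℤ.+ b

IsVal : R → R → ℕ → Set
IsVal ρ r e = (ρ ^R e) ∣R r × (∀ e′ → (ρ ^R e′) ∣R r → e′ ℕ.≤ e)

-- #E(F_p) for E : y² = x³ - 35x + 98: affine solutions in F_p² plus the point at infinity
curveRHS : ℕ → ℕ → ℤ
curveRHS x y = (+ y) ℤ.* (+ y) ℤ.- ((+ x) ℤ.* (+ x) ℤ.* (+ x) ℤ.- + 35 ℤ.* (+ x) ℤ.+ + 98)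

countE : ℕ → ℕ
countE p = suc (length (filter (λ xy → p ∣? ∣ curveRHS (Data.Product.proj₁ xy) (Data.Product.proj₂ xy) ∣)
                                (cartesianProduct (upTo p) (upTo p))))
  where import Data.Product

-- π is (the element representing) the p-Frobenius endomorphism of E over F_p:
-- it is a root of x² - a_p x + p with a_p = p + 1 - #E(F_p)
IsFrobenius : ℕ → R → Set
IsFrobenius p π = norm π ≡ + p × trace π ≡ (+ p ℤ.+ + 1) ℤ.- + countE p

{-# OPTIONS --safe #-}
-- ρ₀ is α or ᾱ = 1 − α: both have norm 2, 2 = α ᾱ and R/ρ₀ ≅ 𝔽₂, so ν(2) = 1.  Which of the two
-- it is never matters.  As N(π) = p is odd, ρ₀ ∤ π, hence P = πⁿ ≡ 1 (mod ρ₀).  Write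
-- P + 1 = (P − 1) + 2.  If ν(P − 1) = 1 = ν(2), both summands are ρ₀ times a unit, and units are
-- ≡ 1 (mod ρ₀), so ρ₀² ∣ P + 1.  If ν(P − 1) ≥ 2 > ν(2), then ν(P + 1) = ν(2) = 1.  Finally, if P
-- is the square of a unit then ρ₀² ∣ P − 1, whence ν(P² − 1) = ν(P − 1) + ν(P + 1) = ν(P − 1) + 1.
module Submission where

open import Defs
open import Data.Nat using (ℕ; suc; _≤_; _+_; _*_; _^_; _%_)
open import Data.Nat.Primality using (Prime)
open import Data.Integer using (ℤ; +_) renaming (_+_ to _+ℤ_; _*_ to _*ℤ_; _-_ to _-ℤ_)
open import Data.Integer.Divisibility renaming (_∣_ to _∣ℤ_)
open import Data.Product using (∃; _×_)
open import Data.Sum using (_⊎_)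
open import Relation.Binary.PropositionalEquality using (_≡_)

open import Algebra.Bundles using (CommutativeRing)
open import Algebra.Consequences.Propositional using (comm∧idˡ⇒id; comm∧invˡ⇒inv; comm∧distrˡ⇒distrʳ)
open import Algebra.Structures {A = R} _≡_ using (IsCommutativeRing)
open import Data.Empty using (⊥-elim)
open import Data.Integer using (-_; ∣_∣; -[1+_])
open import Data.Integer.DivMod using (_/ℕ_; _%ℕ_; n%ℕd<d; a≡a%ℕn+[a/ℕn]*n)
import Data.Integer.Properties as ℤP
import Data.Integer.Tactic.RingSolver as ℤSolver
open import Data.List.Base using ([]; _∷_)
open import Data.Maybe.Base using (Maybe; just; nothing)
open import Data.Nat using (zero; _<_; s≤s; z≤n; ≢-nonZero)
open import Data.Nat.Divisibility as ℕ using (∣1⇒≡1; n∣m⇒m%n≡0)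
open import Data.Nat.Induction using (<-wellFounded)
open import Data.Nat.Primality using (¬prime[1])
import Data.Nat.Properties as ℕP
open import Data.Product using (_,_; proj₁; proj₂)
open import Data.Sum using (inj₁; inj₂; [_,_]′)
import Data.Sum as Sum
open import Function using (_∘_; id)
open import Induction.WellFounded using (Acc; acc)
open import Relation.Binary.PropositionalEquality
  using (_≢_; refl; sym; trans; cong; cong₂; subst; isEquivalence; module ≡-Reasoning)
open import Relation.Nullary using (¬_)
open import Tactic.RingSolver using (solve; solve-∀)
open import Tactic.RingSolver.Core.AlmostCommutativeRing using (AlmostCommutativeRing; fromCommutativeRing)

open ≡-Reasoning

+R-assoc : ∀ x y z → (x +R y) +R z ≡ x +R (y +R z)
+R-assoc (mkR a b) (mkR c d) (mkR e f) = cong₂ mkR (ℤP.+-assoc a c e) (ℤP.+-assoc b d f)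

+R-comm : ∀ x y → x +R y ≡ y +R x
+R-comm (mkR a b) (mkR c d) = cong₂ mkR (ℤP.+-comm a c) (ℤP.+-comm b d)

+R-identityˡ : ∀ x → 0R +R x ≡ x
+R-identityˡ (mkR a b) = cong₂ mkR (ℤP.+-identityˡ a) (ℤP.+-identityˡ b)

-R-inverseˡ : ∀ x → (-R x) +R x ≡ 0R
-R-inverseˡ (mkR a b) = cong₂ mkR (ℤP.+-inverseˡ a) (ℤP.+-inverseˡ b)

*R-comm : ∀ x y → x *R y ≡ y *R x
*R-comm (mkR a b) (mkR c d) = cong₂ mkR (re-eq a b c d) (im-eq a b c d)
  where
  re-eq : ∀ a b c d → a *ℤ c -ℤ + 2 *ℤ (b *ℤ d) ≡ c *ℤ a -ℤ + 2 *ℤ (d *ℤ b)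
  re-eq = ℤSolver.solve-∀
  im-eq : ∀ a b c d → a *ℤ d +ℤ b *ℤ c +ℤ b *ℤ d ≡ c *ℤ b +ℤ d *ℤ a +ℤ d *ℤ b
  im-eq = ℤSolver.solve-∀

*R-assoc : ∀ x y z → (x *R y) *R z ≡ x *R (y *R z)
*R-assoc (mkR a b) (mkR c d) (mkR e f) = cong₂ mkR (re-eq a b c d e f) (im-eq a b c d e f)
  where
  re-eq : ∀ a b c d e f →
    (a *ℤ c -ℤ + 2 *ℤ (b *ℤ d)) *ℤ e -ℤ + 2 *ℤ ((a *ℤ d +ℤ b *ℤ c +ℤ b *ℤ d) *ℤ f)
    ≡ a *ℤ (c *ℤ e -ℤ + 2 *ℤ (d *ℤ f)) -ℤ + 2 *ℤ (b *ℤ (c *ℤ f +ℤ d *ℤ e +ℤ d *ℤ f))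
  re-eq = ℤSolver.solve-∀
  im-eq : ∀ a b c d e f →
    (a *ℤ c -ℤ + 2 *ℤ (b *ℤ d)) *ℤ f +ℤ (a *ℤ d +ℤ b *ℤ c +ℤ b *ℤ d) *ℤ e
      +ℤ (a *ℤ d +ℤ b *ℤ c +ℤ b *ℤ d) *ℤ f
    ≡ a *ℤ (c *ℤ f +ℤ d *ℤ e +ℤ d *ℤ f) +ℤ b *ℤ (c *ℤ e -ℤ + 2 *ℤ (d *ℤ f))
      +ℤ b *ℤ (c *ℤ f +ℤ d *ℤ e +ℤ d *ℤ f)
  im-eq = ℤSolver.solve-∀

*R-identityˡ : ∀ x → 1R *R x ≡ x
*R-identityˡ (mkR a b) = cong₂ mkR (re-eq a b) (im-eq a b)
  where
  re-eq : ∀ a b → + 1 *ℤ a -ℤ + 2 *ℤ (+ 0 *ℤ b) ≡ a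
  re-eq = ℤSolver.solve-∀
  im-eq : ∀ a b → + 1 *ℤ b +ℤ + 0 *ℤ a +ℤ + 0 *ℤ b ≡ b
  im-eq = ℤSolver.solve-∀

*R-distribˡ : ∀ x y z → x *R (y +R z) ≡ (x *R y) +R (x *R z)
*R-distribˡ (mkR a b) (mkR c d) (mkR e f) = cong₂ mkR (re-eq a b c d e f) (im-eq a b c d e f)
  where
  re-eq : ∀ a b c d e f →
    a *ℤ (c +ℤ e) -ℤ + 2 *ℤ (b *ℤ (d +ℤ f))
    ≡ (a *ℤ c -ℤ + 2 *ℤ (b *ℤ d)) +ℤ (a *ℤ e -ℤ + 2 *ℤ (b *ℤ f))
  re-eq = ℤSolver.solve-∀
  im-eq : ∀ a b c d e f →
    a *ℤ (d +ℤ f) +ℤ b *ℤ (c +ℤ e) +ℤ b *ℤ (d +ℤ f)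
    ≡ (a *ℤ d +ℤ b *ℤ c +ℤ b *ℤ d) +ℤ (a *ℤ f +ℤ b *ℤ e +ℤ b *ℤ f)
  im-eq = ℤSolver.solve-∀

R-isCommutativeRing : IsCommutativeRing _+R_ _*R_ -R_ 0R 1R
R-isCommutativeRing = record
  { isRing = record
    { +-isAbelianGroup = record
      { isGroup = record
        { isMonoid = record
          { isSemigroup = record
            { isMagma = record { isEquivalence = isEquivalence ; ∙-cong = cong₂ _+R_ }
            ; assoc = +R-assoc
            }
          ; identity = comm∧idˡ⇒id +R-comm +R-identityˡ
          }
        ; inverse = comm∧invˡ⇒inv +R-comm -R-inverseˡ
        ; ⁻¹-cong = cong (-R_)
        }
      ; comm = +R-comm
      }
    ; *-cong = cong₂ _*R_
    ; *-assoc = *R-assoc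
    ; *-identity = comm∧idˡ⇒id *R-comm *R-identityˡ
    ; distrib = *R-distribˡ , comm∧distrˡ⇒distrʳ *R-comm *R-distribˡ
    }
  ; *-comm = *R-comm
  }

R-commutativeRing : CommutativeRing _ _
R-commutativeRing = record { isCommutativeRing = R-isCommutativeRing }

R-ring : AlmostCommutativeRing _ _
R-ring = fromCommutativeRing R-commutativeRing isZero
  where
  isZero : ∀ x → Maybe (0R ≡ x)
  isZero (mkR (+ 0) (+ 0)) = just refl
  isZero _ = nothing

open CommutativeRing R-commutativeRing
  using (+-abelianGroup; *-commutativeSemigroup; zeroˡ; zeroʳ)
  renaming (+-identityʳ to +R-identityʳ; *-identityʳ to *R-identityʳ)
open import Algebra.Properties.AbelianGroup +-abelianGroup using (x∙y⁻¹≈ε⇒x≈y; inverseˡ-unique)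
open import Algebra.Properties.CommutativeSemigroup *-commutativeSemigroup using (x∙yz≈y∙zx; interchange)

P+1≡[P-1]+2 : ∀ P → P +R 1R ≡ (P -R 1R) +R (1R +R 1R)
P+1≡[P-1]+2 = solve-∀ R-ring

P²-1≡[P-1][P+1] : ∀ P → P *R P -R 1R ≡ (P -R 1R) *R (P +R 1R)
P²-1≡[P-1][P+1] = solve-∀ R-ring

∣R-+-cancelˡ : ∀ {x y z} → x ∣R (y +R z) → x ∣R y → x ∣R z
∣R-+-cancelˡ {x} {y} {z} (c , cx≡y+z) (d , dx≡y) = c -R d , (begin
  (c -R d) *R x      ≡⟨ solve (c ∷ d ∷ x ∷ []) R-ring ⟩
  c *R x -R d *R x   ≡⟨ cong₂ _-R_ cx≡y+z dx≡y ⟩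
  (y +R z) -R y      ≡⟨ solve (y ∷ z ∷ []) R-ring ⟩
  z                  ∎)

∣R-trans : ∀ {x y z} → x ∣R y → y ∣R z → x ∣R z
∣R-trans {x} (c , cx≡y) (d , dy≡z) = d *R c , trans (*R-assoc d c x) (trans (cong (d *R_) cx≡y) dy≡z)

^R-+ : ∀ x m n → x ^R (m + n) ≡ x ^R m *R x ^R n
^R-+ x zero    n = sym (*R-identityˡ _)
^R-+ x (suc m) n = trans (cong (x *R_) (^R-+ x m n)) (sym (*R-assoc x _ _))

^R-∣ : ∀ x {m n} → m ≤ n → (x ^R m) ∣R (x ^R n)
^R-∣ x {m} m≤n with ℕP.m≤n⇒∃[o]m+o≡n m≤n
... | k , refl = x ^R k , trans (*R-comm (x ^R k) (x ^R m)) (sym (^R-+ x m k))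

^R-double : ∀ x i n → x ^R (2 ^ suc i * n) ≡ x ^R (2 ^ i * n) *R x ^R (2 ^ i * n)
^R-double x i n = trans (cong (x ^R_) 2^[1+i]*n≡m+m) (^R-+ x (2 ^ i * n) (2 ^ i * n))
  where
  2^[1+i]*n≡m+m : 2 ^ suc i * n ≡ 2 ^ i * n + 2 ^ i * n
  2^[1+i]*n≡m+m = trans (ℕP.*-assoc 2 (2 ^ i) n) (cong (λ m → 2 ^ i * n + m) (ℕP.+-identityʳ _))

norm-*R : ∀ x y → norm (x *R y) ≡ norm x *ℤ norm y
norm-*R (mkR a b) (mkR c d) = eq a b c d
  where
  eq : ∀ a b c d →
    (a *ℤ c -ℤ + 2 *ℤ (b *ℤ d)) *ℤ (a *ℤ c -ℤ + 2 *ℤ (b *ℤ d))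
      +ℤ (a *ℤ c -ℤ + 2 *ℤ (b *ℤ d)) *ℤ (a *ℤ d +ℤ b *ℤ c +ℤ b *ℤ d)
      +ℤ + 2 *ℤ ((a *ℤ d +ℤ b *ℤ c +ℤ b *ℤ d) *ℤ (a *ℤ d +ℤ b *ℤ c +ℤ b *ℤ d))
    ≡ (a *ℤ a +ℤ a *ℤ b +ℤ + 2 *ℤ (b *ℤ b)) *ℤ (c *ℤ c +ℤ c *ℤ d +ℤ + 2 *ℤ (d *ℤ d))
  eq = ℤSolver.solve-∀

+∣i∣*∣i∣≡i*i : ∀ i → + (∣ i ∣ * ∣ i ∣) ≡ i *ℤ i
+∣i∣*∣i∣≡i*i (+ n)     = ℤP.pos-* n n
+∣i∣*∣i∣≡i*i -[1+ n ]  = refl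

i²+7j²≡0⇒i≡0×j≡0 : ∀ i j → i *ℤ i +ℤ + 7 *ℤ (j *ℤ j) ≡ + 0 → i ≡ + 0 × j ≡ + 0
i²+7j²≡0⇒i≡0×j≡0 i j eq =
    ℤP.∣i∣≡0⇒i≡0 (m*m≡0⇒m≡0 (ℕP.m+n≡0⇒m≡0 _ sum≡0))
  , ℤP.∣i∣≡0⇒i≡0 (m*m≡0⇒m≡0 ([ (λ ()) , id ]′ (ℕP.m*n≡0⇒m≡0∨n≡0 7 (ℕP.m+n≡0⇒n≡0 (∣ i ∣ * ∣ i ∣) sum≡0))))
  where
  m*m≡0⇒m≡0 : ∀ {m} → m * m ≡ 0 → m ≡ 0
  m*m≡0⇒m≡0 {m} m*m≡0 = [ id , id ]′ (ℕP.m*n≡0⇒m≡0∨n≡0 m m*m≡0)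
  sum≡0 : ∣ i ∣ * ∣ i ∣ + 7 * (∣ j ∣ * ∣ j ∣) ≡ 0
  sum≡0 = ℤP.+-injective (begin
    + (∣ i ∣ * ∣ i ∣ + 7 * (∣ j ∣ * ∣ j ∣))
      ≡⟨ ℤP.pos-+ (∣ i ∣ * ∣ i ∣) (7 * (∣ j ∣ * ∣ j ∣)) ⟩
    + (∣ i ∣ * ∣ i ∣) +ℤ + (7 * (∣ j ∣ * ∣ j ∣))
      ≡⟨ cong (+ (∣ i ∣ * ∣ i ∣) +ℤ_) (ℤP.pos-* 7 (∣ j ∣ * ∣ j ∣)) ⟩
    + (∣ i ∣ * ∣ i ∣) +ℤ + 7 *ℤ + (∣ j ∣ * ∣ j ∣)
      ≡⟨ cong₂ (λ s t → s +ℤ + 7 *ℤ t) (+∣i∣*∣i∣≡i*i i) (+∣i∣*∣i∣≡i*i j) ⟩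
    i *ℤ i +ℤ + 7 *ℤ (j *ℤ j)
      ≡⟨ eq ⟩
    + 0 ∎)

norm≡0⇒≡0R : ∀ {x} → norm x ≡ + 0 → x ≡ 0R
norm≡0⇒≡0R {mkR a b} norm≡0 = cong₂ mkR a≡0 b≡0
  where
  four-norm : ∀ a b →
    (+ 2 *ℤ a +ℤ b) *ℤ (+ 2 *ℤ a +ℤ b) +ℤ + 7 *ℤ (b *ℤ b)
    ≡ + 4 *ℤ (a *ℤ a +ℤ a *ℤ b +ℤ + 2 *ℤ (b *ℤ b))
  four-norm = ℤSolver.solve-∀
  2a+b≡0×b≡0 : + 2 *ℤ a +ℤ b ≡ + 0 × b ≡ + 0
  2a+b≡0×b≡0 = i²+7j²≡0⇒i≡0×j≡0 _ b (trans (four-norm a b) (cong (+ 4 *ℤ_) norm≡0))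
  b≡0 : b ≡ + 0
  b≡0 = proj₂ 2a+b≡0×b≡0
  a≡0 : a ≡ + 0
  a≡0 = ℤP.*-cancelˡ-≡ (+ 2) a (+ 0) (begin
    + 2 *ℤ a         ≡⟨ sym (ℤP.+-identityʳ _) ⟩
    + 2 *ℤ a +ℤ + 0  ≡⟨ cong (+ 2 *ℤ a +ℤ_) (sym b≡0) ⟩
    + 2 *ℤ a +ℤ b    ≡⟨ proj₁ 2a+b≡0×b≡0 ⟩
    + 0              ∎)

*R-cancelˡ : ∀ {x y z} → x ≢ 0R → x *R y ≡ x *R z → y ≡ z
*R-cancelˡ {x} {y} {z} x≢0 xy≡xz =
  x∙y⁻¹≈ε⇒x≈y y z (norm≡0⇒≡0R ([ ⊥-elim ∘ x≢0 ∘ norm≡0⇒≡0R , id ]′ (ℤP.i*j≡0⇒i≡0∨j≡0 (norm x) norm≡0)))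
  where
  x[y-z]≡0 : x *R (y -R z) ≡ 0R
  x[y-z]≡0 = begin
    x *R (y -R z)     ≡⟨ solve (x ∷ y ∷ z ∷ []) R-ring ⟩
    x *R y -R x *R z  ≡⟨ cong (_-R x *R z) xy≡xz ⟩
    x *R z -R x *R z  ≡⟨ solve (x ∷ z ∷ []) R-ring ⟩
    0R                ∎
  norm≡0 : norm x *ℤ norm (y -R z) ≡ + 0
  norm≡0 = trans (sym (norm-*R x (y -R z))) (cong norm x[y-z]≡0)

^R-cancelˡ : ∀ {x} → x ≢ 0R → ∀ e {a b} → x ^R e *R a ≡ x ^R e *R b → a ≡ b
^R-cancelˡ x≢0 zero {a} {b} eq = trans (sym (*R-identityˡ a)) (trans eq (*R-identityˡ b))
^R-cancelˡ {x} x≢0 (suc e) {a} {b} eq =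
  ^R-cancelˡ x≢0 e (*R-cancelˡ x≢0 (trans (sym (*R-assoc x _ a)) (trans eq (*R-assoc x _ b))))

∣norm∣≢1⇒norm[x^1+n]≢1 : ∀ {x} → ∣ norm x ∣ ≢ 1 → ∀ n → norm (x ^R suc n) ≢ + 1
∣norm∣≢1⇒norm[x^1+n]≢1 {x} ∣norm[x]∣≢1 n norm≡1 = ∣norm[x]∣≢1 (ℕP.m*n≡1⇒m≡1 _ _ (begin
  ∣ norm x ∣ * ∣ norm (x ^R n) ∣  ≡⟨ sym (ℤP.abs-* (norm x) _) ⟩
  ∣ norm x *ℤ norm (x ^R n) ∣     ≡⟨ cong ∣_∣ (sym (norm-*R x _)) ⟩
  ∣ norm (x ^R suc n) ∣           ≡⟨ cong ∣_∣ norm≡1 ⟩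
  1                               ∎))

x^n-1≢0 : ∀ {x} → ∣ norm x ∣ ≢ 1 → ∀ {n} → 1 ≤ n → x ^R n -R 1R ≢ 0R
x^n-1≢0 {x} ∣norm[x]∣≢1 {suc n} _ eq =
  ∣norm∣≢1⇒norm[x^1+n]≢1 {x} ∣norm[x]∣≢1 n (cong norm (x∙y⁻¹≈ε⇒x≈y (x ^R suc n) 1R eq))

x^n+1≢0 : ∀ {x} → ∣ norm x ∣ ≢ 1 → ∀ {n} → 1 ≤ n → x ^R n +R 1R ≢ 0R
x^n+1≢0 {x} ∣norm[x]∣≢1 {suc n} _ eq =
  ∣norm∣≢1⇒norm[x^1+n]≢1 {x} ∣norm[x]∣≢1 n (cong norm (inverseˡ-unique (x ^R suc n) 1R eq))

IsVal-unique : ∀ ρ x {e f} → IsVal ρ x e → IsVal ρ x f → e ≡ f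
IsVal-unique _ _ (ρ^e∣x , e-max) (ρ^f∣x , f-max) = ℕP.≤-antisym (f-max _ ρ^e∣x) (e-max _ ρ^f∣x)

IsVal⇒≢0R : ∀ ρ x {e} → IsVal ρ x e → x ≢ 0R
IsVal⇒≢0R ρ x {e} (_ , e-max) x≡0 =
  ℕP.<-irrefl refl (e-max (suc e) (0R , trans (zeroˡ (ρ ^R suc e)) (sym x≡0)))

IsVal-∣ : ∀ ρ x {e m} → IsVal ρ x e → m ≤ e → (ρ ^R m) ∣R x
IsVal-∣ ρ _ (ρ^e∣x , _) m≤e = ∣R-trans (^R-∣ ρ m≤e) ρ^e∣x

Residue₀₁ : R → R → Set
Residue₀₁ ρ x = (∃ λ y → x ≡ ρ *R y) ⊎ (∃ λ y → x ≡ ρ *R y +R 1R)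

residue-of-remainder : ∀ ρ {x} y {r} → r < 2 → x ≡ ρ *R y +R ι (+ r) → Residue₀₁ ρ x
residue-of-remainder ρ y {0}           _                eq = inj₁ (y , trans eq (+R-identityʳ (ρ *R y)))
residue-of-remainder _ y {1}           _                eq = inj₂ (y , eq)
residue-of-remainder _ y {suc (suc _)} (s≤s (s≤s ())) _

-- a + bα = α ((b + q) − qα) + r  where  a = 2q + r
residueα : ∀ x → Residue₀₁ αR x
residueα (mkR a b) = residue-of-remainder αR (mkR (b +ℤ q) (- q)) (n%ℕd<d a 2)
  (cong₂ mkR (trans (a≡a%ℕn+[a/ℕn]*n a 2) (re-eq (+ (a %ℕ 2)) q b)) (im-eq q b))
  where
  q : ℤ
  q = a /ℕ 2
  re-eq : ∀ r q b → r +ℤ q *ℤ + 2 ≡ (+ 0 *ℤ (b +ℤ q) -ℤ + 2 *ℤ (+ 1 *ℤ (- q))) +ℤ r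
  re-eq = ℤSolver.solve-∀
  im-eq : ∀ q b → b ≡ (+ 0 *ℤ (- q) +ℤ + 1 *ℤ (b +ℤ q) +ℤ + 1 *ℤ (- q)) +ℤ + 0
  im-eq = ℤSolver.solve-∀

-- a + bα = ᾱ (−b + qα) + r  where  a + b = 2q + r
residueᾱ : ∀ x → Residue₀₁ αbar x
residueᾱ (mkR a b) = residue-of-remainder αbar (mkR (- b) q) (n%ℕd<d (a +ℤ b) 2)
  (cong₂ mkR (trans (a≡[a+b]-b a b)
                    (trans (cong (_-ℤ b) (a≡a%ℕn+[a/ℕn]*n (a +ℤ b) 2)) (re-eq (+ ((a +ℤ b) %ℕ 2)) q b)))
             (im-eq q b))
  where
  q : ℤ
  q = (a +ℤ b) /ℕ 2
  a≡[a+b]-b : ∀ a b → a ≡ (a +ℤ b) -ℤ b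
  a≡[a+b]-b = ℤSolver.solve-∀
  re-eq : ∀ r q b → (r +ℤ q *ℤ + 2) -ℤ b ≡ (+ 1 *ℤ (- b) -ℤ + 2 *ℤ (- + 1 *ℤ q)) +ℤ r
  re-eq = ℤSolver.solve-∀
  im-eq : ∀ q b → b ≡ (+ 1 *ℤ q +ℤ - + 1 *ℤ (- b) +ℤ - + 1 *ℤ q) +ℤ + 0
  im-eq = ℤSolver.solve-∀

-- 1 − ρ is the conjugate of ρ, so the second field says 2 = ρ ρ̄.
record PrimeAbove2 (ρ : R) : Set where
  field
    norm≡2   : norm ρ ≡ + 2
    ρ[1-ρ]≡2 : ρ *R (1R -R ρ) ≡ 1R +R 1R
    residue  : ∀ x → Residue₀₁ ρ x

α-primeAbove2 : PrimeAbove2 αR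
α-primeAbove2 = record { norm≡2 = refl ; ρ[1-ρ]≡2 = refl ; residue = residueα }

ᾱ-primeAbove2 : PrimeAbove2 αbar
ᾱ-primeAbove2 = record { norm≡2 = refl ; ρ[1-ρ]≡2 = refl ; residue = residueᾱ }

α∨ᾱ-primeAbove2 : ∀ {ρ} → ρ ≡ αR ⊎ ρ ≡ αbar → PrimeAbove2 ρ
α∨ᾱ-primeAbove2 (inj₁ refl) = α-primeAbove2
α∨ᾱ-primeAbove2 (inj₂ refl) = ᾱ-primeAbove2

module PrimeAbove2Properties {ρ : R} (ρ-prime : PrimeAbove2 ρ) where

  open PrimeAbove2 ρ-prime

  ∣norm[x*ρ]∣≡∣norm[x]∣*2 : ∀ x → ∣ norm (x *R ρ) ∣ ≡ ∣ norm x ∣ * 2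
  ∣norm[x*ρ]∣≡∣norm[x]∣*2 x = begin
    ∣ norm (x *R ρ) ∣          ≡⟨ cong ∣_∣ (norm-*R x ρ) ⟩
    ∣ norm x *ℤ norm ρ ∣       ≡⟨ ℤP.abs-* (norm x) (norm ρ) ⟩
    ∣ norm x ∣ * ∣ norm ρ ∣    ≡⟨ cong (λ n → ∣ norm x ∣ * ∣ n ∣) norm≡2 ⟩
    ∣ norm x ∣ * 2             ∎

  ρ∣⇒2∣∣norm∣ : ∀ {x} → ρ ∣R x → 2 ℕ.∣ ∣ norm x ∣
  ρ∣⇒2∣∣norm∣ (c , cρ≡x) =
    ℕ.divides ∣ norm c ∣ (trans (cong (∣_∣ ∘ norm) (sym cρ≡x)) (∣norm[x*ρ]∣≡∣norm[x]∣*2 c))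

  odd-norm⇒ρ∤ : ∀ {x} → ∣ norm x ∣ % 2 ≡ 1 → ¬ ρ ∣R x
  odd-norm⇒ρ∤ odd ρ∣x with trans (sym (n∣m⇒m%n≡0 _ 2 (ρ∣⇒2∣∣norm∣ ρ∣x))) odd
  ... | ()

  ρ∤1 : ¬ ρ ∣R 1R
  ρ∤1 ρ∣1 with ∣1⇒≡1 (ρ∣⇒2∣∣norm∣ ρ∣1)
  ... | ()

  ρ≢0R : ρ ≢ 0R
  ρ≢0R ρ≡0 with trans (sym norm≡2) (cong norm ρ≡0)
  ... | ()

  ρ∤ρy+1 : ∀ y → ¬ ρ ∣R (ρ *R y +R 1R)
  ρ∤ρy+1 y ρ∣ρy+1 = ρ∤1 (∣R-+-cancelˡ ρ∣ρy+1 (y , *R-comm y ρ))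

  ρ∤⇒≡1 : ∀ {u} → ¬ ρ ∣R u → ∃ λ v → u ≡ ρ *R v +R 1R
  ρ∤⇒≡1 {u} ρ∤u = [ (λ (v , u≡ρv) → ⊥-elim (ρ∤u (v , trans (*R-comm v ρ) (sym u≡ρv)))) , id ]′ (residue u)

  ρ∤⇒ρ∣-1 : ∀ {u} → ¬ ρ ∣R u → ρ ∣R (u -R 1R)
  ρ∤⇒ρ∣-1 ρ∤u with ρ∤⇒≡1 ρ∤u
  ... | v , refl = v , vρ≡[ρv+1]-1
    where
    vρ≡[ρv+1]-1 : v *R ρ ≡ (ρ *R v +R 1R) -R 1R
    vρ≡[ρv+1]-1 = solve (ρ ∷ v ∷ []) R-ring

  ρ∤-* : ∀ {u w} → ¬ ρ ∣R u → ¬ ρ ∣R w → ¬ ρ ∣R (u *R w)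
  ρ∤-* ρ∤u ρ∤w with ρ∤⇒≡1 ρ∤u | ρ∤⇒≡1 ρ∤w
  ... | v , refl | v′ , refl = subst (¬_ ∘ (ρ ∣R_)) (sym product≡) (ρ∤ρy+1 (v *R (ρ *R v′ +R 1R) +R v′))
    where
    product≡ : (ρ *R v +R 1R) *R (ρ *R v′ +R 1R) ≡ ρ *R (v *R (ρ *R v′ +R 1R) +R v′) +R 1R
    product≡ = solve (ρ ∷ v ∷ v′ ∷ []) R-ring

  ρ∤-^ : ∀ {u} → ¬ ρ ∣R u → ∀ n → ¬ ρ ∣R (u ^R n)
  ρ∤-^ ρ∤u zero    = ρ∤1
  ρ∤-^ ρ∤u (suc n) = ρ∤-* ρ∤u (ρ∤-^ ρ∤u n)

  ρ∤+ρ∤⇒ρ∣+ : ∀ {u w} → ¬ ρ ∣R u → ¬ ρ ∣R w → ρ ∣R (u +R w)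
  ρ∤+ρ∤⇒ρ∣+ ρ∤u ρ∤w with ρ∤⇒≡1 ρ∤u | ρ∤⇒≡1 ρ∤w
  ... | v , refl | v′ , refl = v +R v′ +R (1R -R ρ) , (begin
    (v +R v′ +R (1R -R ρ)) *R ρ           ≡⟨ solve (ρ ∷ v ∷ v′ ∷ []) R-ring ⟩
    ρ *R v +R ρ *R v′ +R ρ *R (1R -R ρ)   ≡⟨ cong (ρ *R v +R ρ *R v′ +R_) ρ[1-ρ]≡2 ⟩
    ρ *R v +R ρ *R v′ +R (1R +R 1R)       ≡⟨ solve (ρ ∷ v ∷ v′ ∷ []) R-ring ⟩
    (ρ *R v +R 1R) +R (ρ *R v′ +R 1R)     ∎)

  ρ∤x⇒ρ²∣x²-1 : ∀ {x} → ¬ ρ ∣R x → (ρ ^R 2) ∣R (x *R x -R 1R)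
  ρ∤x⇒ρ²∣x²-1 ρ∤x with ρ∤⇒≡1 ρ∤x
  ... | v , refl = v *R v +R (1R -R ρ) *R v , (begin
    (v *R v +R (1R -R ρ) *R v) *R (ρ *R (ρ *R 1R))
      ≡⟨ solve (ρ ∷ v ∷ []) R-ring ⟩
    ρ *R ρ *R (v *R v) +R ρ *R (1R -R ρ) *R (ρ *R v)
      ≡⟨ cong (λ t → ρ *R ρ *R (v *R v) +R t *R (ρ *R v)) ρ[1-ρ]≡2 ⟩
    ρ *R ρ *R (v *R v) +R (1R +R 1R) *R (ρ *R v)
      ≡⟨ solve (ρ ∷ v ∷ []) R-ring ⟩
    (ρ *R v +R 1R) *R (ρ *R v +R 1R) -R 1R ∎)

  infix 4 ρ^_∥_
  data ρ^_∥_ (e : ℕ) (x : R) : Set where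
    mk∥ : ∀ u → x ≡ ρ ^R e *R u → ¬ ρ ∣R u → ρ^ e ∥ x

  ρ^1∥2 : ρ^ 1 ∥ (1R +R 1R)
  ρ^1∥2 = mk∥ (1R -R ρ) (trans (sym ρ[1-ρ]≡2) (cong (_*R (1R -R ρ)) (sym (*R-identityʳ ρ)))) ρ∤1-ρ
    where
    1-ρ≡ρ[-1]+1 : 1R -R ρ ≡ ρ *R (-R 1R) +R 1R
    1-ρ≡ρ[-1]+1 = solve (ρ ∷ []) R-ring
    ρ∤1-ρ : ¬ ρ ∣R (1R -R ρ)
    ρ∤1-ρ = subst (¬_ ∘ (ρ ∣R_)) (sym 1-ρ≡ρ[-1]+1) (ρ∤ρy+1 (-R 1R))

  ∥-ρ* : ∀ {e y} → ρ^ e ∥ y → ρ^ suc e ∥ (ρ *R y)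
  ∥-ρ* {e} (mk∥ u y≡ρ^eu ρ∤u) = mk∥ u (trans (cong (ρ *R_) y≡ρ^eu) (sym (*R-assoc ρ (ρ ^R e) u))) ρ∤u

  ∥-exists : ∀ {x} → x ≢ 0R → ∃ λ e → ρ^ e ∥ x
  ∥-exists {x} = go x (<-wellFounded ∣ norm x ∣)
    where
    ∣norm∣-decreases : ∀ y → y ≢ 0R → ∣ norm y ∣ < ∣ norm (ρ *R y) ∣
    ∣norm∣-decreases y y≢0 =
      subst (∣ norm y ∣ <_) (trans (sym (∣norm[x*ρ]∣≡∣norm[x]∣*2 y)) (cong (∣_∣ ∘ norm) (*R-comm y ρ)))
        (ℕP.m<m*n ∣ norm y ∣ 2 {{≢-nonZero (y≢0 ∘ norm≡0⇒≡0R ∘ ℤP.∣i∣≡0⇒i≡0)}} (s≤s (s≤s z≤n)))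
    go : ∀ x → Acc _<_ ∣ norm x ∣ → x ≢ 0R → ∃ λ e → ρ^ e ∥ x
    go x _ _ with residue x
    go _ _ _ | inj₂ (y , refl) = 0 , mk∥ (ρ *R y +R 1R) (sym (*R-identityˡ (ρ *R y +R 1R))) (ρ∤ρy+1 y)
    go _ (acc smaller) ρy≢0 | inj₁ (y , refl) =
      let e , ρ^e∥y = go y (smaller (∣norm∣-decreases y y≢0)) y≢0 in suc e , ∥-ρ* ρ^e∥y
      where
      y≢0 : y ≢ 0R
      y≢0 y≡0 = ρy≢0 (trans (cong (ρ *R_) y≡0) (zeroʳ ρ))

  ρ^1+e∣ρ^e*u⇒ρ∣u : ∀ e {u} → (ρ ^R suc e) ∣R (ρ ^R e *R u) → ρ ∣R u
  ρ^1+e∣ρ^e*u⇒ρ∣u e (c , c[ρρ^e]≡ρ^eu) = c , ^R-cancelˡ ρ≢0R e (trans (x∙yz≈y∙zx (ρ ^R e) c ρ) c[ρρ^e]≡ρ^eu)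

  ∥⇒IsVal : ∀ {e x} → ρ^ e ∥ x → IsVal ρ x e
  ∥⇒IsVal {e} {x} (mk∥ u x≡ρ^eu ρ∤u) = (u , trans (*R-comm u (ρ ^R e)) (sym x≡ρ^eu)) , maximal
    where
    maximal : ∀ e′ → (ρ ^R e′) ∣R x → e′ ≤ e
    maximal e′ ρ^e′∣x = ℕP.≮⇒≥ λ e<e′ →
      ρ∤u (ρ^1+e∣ρ^e*u⇒ρ∣u e (∣R-trans (^R-∣ ρ e<e′) (subst ((ρ ^R e′) ∣R_) x≡ρ^eu ρ^e′∣x)))

  valuation : ∀ {x} → x ≢ 0R → ∃ λ e → IsVal ρ x e
  valuation x≢0 = let e , ρ^e∥x = ∥-exists x≢0 in e , ∥⇒IsVal ρ^e∥x

  IsVal⇒∥ : ∀ x {e} → IsVal ρ x e → ρ^ e ∥ x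
  IsVal⇒∥ x ν = let e′ , ρ^e′∥x = ∥-exists (IsVal⇒≢0R ρ x ν) in
    subst (λ e → ρ^ e ∥ x) (IsVal-unique ρ x (∥⇒IsVal ρ^e′∥x) ν) ρ^e′∥x

  ∥-* : ∀ {e f x y} → ρ^ e ∥ x → ρ^ f ∥ y → ρ^ (e + f) ∥ (x *R y)
  ∥-* {e} {f} {x} {y} (mk∥ u x≡ ρ∤u) (mk∥ w y≡ ρ∤w) = mk∥ (u *R w) xy≡ (ρ∤-* ρ∤u ρ∤w)
    where
    xy≡ : x *R y ≡ ρ ^R (e + f) *R (u *R w)
    xy≡ = begin
      x *R y                            ≡⟨ cong₂ _*R_ x≡ y≡ ⟩
      (ρ ^R e *R u) *R (ρ ^R f *R w)    ≡⟨ interchange (ρ ^R e) u (ρ ^R f) w ⟩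
      (ρ ^R e *R ρ ^R f) *R (u *R w)    ≡⟨ cong (_*R (u *R w)) (sym (^R-+ ρ e f)) ⟩
      ρ ^R (e + f) *R (u *R w)          ∎

  ∥-+-∣ : ∀ {e x y} → (ρ ^R suc e) ∣R x → ρ^ e ∥ y → ρ^ e ∥ (x +R y)
  ∥-+-∣ {e} {x} {y} (c , c[ρρ^e]≡x) (mk∥ w y≡ ρ∤w) = mk∥ (c *R ρ +R w) x+y≡ ρ∤cρ+w
    where
    x+y≡ : x +R y ≡ ρ ^R e *R (c *R ρ +R w)
    x+y≡ = begin
      x +R y                               ≡⟨ cong₂ _+R_ (sym c[ρρ^e]≡x) y≡ ⟩
      c *R (ρ *R ρ ^R e) +R ρ ^R e *R w    ≡⟨ cong (_+R ρ ^R e *R w) (sym (x∙yz≈y∙zx (ρ ^R e) c ρ)) ⟩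
      ρ ^R e *R (c *R ρ) +R ρ ^R e *R w    ≡⟨ sym (*R-distribˡ (ρ ^R e) (c *R ρ) w) ⟩
      ρ ^R e *R (c *R ρ +R w)              ∎
    ρ∤cρ+w : ¬ ρ ∣R (c *R ρ +R w)
    ρ∤cρ+w ρ∣cρ+w = ρ∤w (∣R-+-cancelˡ ρ∣cρ+w (c , refl))

  ∥-+-∥ : ∀ {e x y} → ρ^ e ∥ x → ρ^ e ∥ y → (ρ ^R suc e) ∣R (x +R y)
  ∥-+-∥ {e} {x} {y} (mk∥ u x≡ ρ∤u) (mk∥ w y≡ ρ∤w) = c , (begin
    c *R (ρ *R ρ ^R e)            ≡⟨ sym (x∙yz≈y∙zx (ρ ^R e) c ρ) ⟩
    ρ ^R e *R (c *R ρ)            ≡⟨ cong (ρ ^R e *R_) cρ≡u+w ⟩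
    ρ ^R e *R (u +R w)            ≡⟨ *R-distribˡ (ρ ^R e) u w ⟩
    ρ ^R e *R u +R ρ ^R e *R w    ≡⟨ sym (cong₂ _+R_ x≡ y≡) ⟩
    x +R y                        ∎)
    where
    c : R
    c = proj₁ (ρ∤+ρ∤⇒ρ∣+ ρ∤u ρ∤w)
    cρ≡u+w : c *R ρ ≡ u +R w
    cρ≡u+w = proj₂ (ρ∤+ρ∤⇒ρ∣+ ρ∤u ρ∤w)

  ρ∣⇒1≤ν : ∀ {x} → x ≢ 0R → ρ ∣R x → ∃ λ e → IsVal ρ x e × 1 ≤ e
  ρ∣⇒1≤ν {x} x≢0 ρ∣x = let e , ν = valuation x≢0 in
    e , ν , proj₂ ν 1 (subst (_∣R x) (sym (*R-identityʳ ρ)) ρ∣x)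

  ν[P-1]≡1⇒2≤ν[P+1] : ∀ P → P +R 1R ≢ 0R → IsVal ρ (P -R 1R) 1 →
    ∃ λ e → IsVal ρ (P +R 1R) e × 2 ≤ e
  ν[P-1]≡1⇒2≤ν[P+1] P P+1≢0 ν[P-1]≡1 = let e , ν = valuation P+1≢0 in e , ν , proj₂ ν 2 ρ²∣P+1
    where
    ρ²∣P+1 : (ρ ^R 2) ∣R (P +R 1R)
    ρ²∣P+1 = subst ((ρ ^R 2) ∣R_) (sym (P+1≡[P-1]+2 P)) (∥-+-∥ (IsVal⇒∥ (P -R 1R) ν[P-1]≡1) ρ^1∥2)

  2≤ν[P-1]⇒ν[P+1]≡1 : ∀ P {e} → IsVal ρ (P -R 1R) e → 2 ≤ e → IsVal ρ (P +R 1R) 1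
  2≤ν[P-1]⇒ν[P+1]≡1 P ν 2≤e =
    ∥⇒IsVal (subst (ρ^ 1 ∥_) (sym (P+1≡[P-1]+2 P)) (∥-+-∣ (IsVal-∣ ρ (P -R 1R) ν 2≤e) ρ^1∥2))

  ν[P²-1]≡ν[P-1]+1 : ∀ P {e} → IsVal ρ (P -R 1R) e → 2 ≤ e → IsVal ρ (P *R P -R 1R) (e + 1)
  ν[P²-1]≡ν[P-1]+1 P {e} ν 2≤e = ∥⇒IsVal (subst (ρ^ e + 1 ∥_) (sym (P²-1≡[P-1][P+1] P))
    (∥-* (IsVal⇒∥ (P -R 1R) ν) (IsVal⇒∥ (P +R 1R) (2≤ν[P-1]⇒ν[P+1]≡1 P ν 2≤e))))

  ν-doubling : ∀ {x} → ¬ ρ ∣R x → ∀ i n {e} →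
    IsVal ρ (x ^R (2 ^ suc i * n) -R 1R) e → IsVal ρ (x ^R (2 ^ suc (suc i) * n) -R 1R) (e + 1)
  ν-doubling {x} ρ∤x i n {e} ν = subst (λ y → IsVal ρ (y -R 1R) (e + 1)) (sym (^R-double x (suc i) n))
    (ν[P²-1]≡ν[P-1]+1 (x ^R (2 ^ suc i * n)) ν 2≤e)
    where
    2≤e : 2 ≤ e
    2≤e = proj₂ ν 2 (subst (λ y → (ρ ^R 2) ∣R (y -R 1R)) (sym (^R-double x i n))
                          (ρ∤x⇒ρ²∣x²-1 (ρ∤-^ ρ∤x (2 ^ i * n))))

lemma2p10 : (p : ℕ) → Prime p → p % 2 ≡ 1 → (p % 7 ≡ 1 ⊎ p % 7 ≡ 2 ⊎ p % 7 ≡ 4) →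
    (h k : ℤ) → (+ p) ∣ℤ (+ 2 *ℤ h -ℤ + 1) → (+ p) ∣ℤ (k *ℤ k +ℤ h *ℤ k +ℤ h) →
    (π : R) → IsFrobenius p π →
    (ρ₀ : R) →
    ((ρ₀ ≡ αR × αR ≡R ι (+ 2 *ℤ k +ℤ + 1) [mod π ]) ⊎ (ρ₀ ≡ αbar × αbar ≡R ι (+ 2 *ℤ k +ℤ + 1) [mod π ])) →
    (n : ℕ) → 1 ≤ n →
    (∃ λ e → IsVal ρ₀ (π ^R n -R 1R) e × 1 ≤ e)
    × (IsVal ρ₀ (π ^R n -R 1R) 1 → ∃ λ e → IsVal ρ₀ (π ^R n +R 1R) e × 2 ≤ e)
    × (∀ e → IsVal ρ₀ (π ^R n -R 1R) e → 2 ≤ e → IsVal ρ₀ (π ^R n +R 1R) 1)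
    × (∀ i → 1 ≤ i → ∀ e → IsVal ρ₀ (π ^R (2 ^ i * n) -R 1R) e →
         IsVal ρ₀ (π ^R (2 ^ (suc i) * n) -R 1R) (e + 1))
lemma2p10 p p-prime p-odd _ _ _ _ _ π (norm-π , _) ρ₀ ρ₀-choice n 1≤n =
    ρ∣⇒1≤ν (x^n-1≢0 ∣norm[π]∣≢1 1≤n) (ρ∤⇒ρ∣-1 (ρ∤-^ ρ₀∤π n))
  , ν[P-1]≡1⇒2≤ν[P+1] (π ^R n) (x^n+1≢0 ∣norm[π]∣≢1 1≤n)
  , (λ _ → 2≤ν[P-1]⇒ν[P+1]≡1 (π ^R n))
  , λ { zero () ; (suc i) _ _ → ν-doubling ρ₀∤π i n }
  where
  open PrimeAbove2Properties (α∨ᾱ-primeAbove2 (Sum.map proj₁ proj₁ ρ₀-choice))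
  ∣norm[π]∣≢1 : ∣ norm π ∣ ≢ 1
  ∣norm[π]∣≢1 ∣norm[π]∣≡1 = ¬prime[1] (subst Prime (trans (cong ∣_∣ (sym norm-π)) ∣norm[π]∣≡1) p-prime)
  ρ₀∤π : ¬ ρ₀ ∣R π
  ρ₀∤π = odd-norm⇒ρ∤ (subst (λ z → ∣ z ∣ % 2 ≡ 1) (sym norm-π) p-odd)
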